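{- Let $p$ be a prime and let $e$ be the entry point of the Fibonacci sequence modulo $p$. For $n\ge1$ let $R_n$ be the $n\times n$ matrix with $(i,j)$ entry $\binom{i-1}{n-j}$. Then for every $k\ge1$, \[ R_{2k}^{\,e}\equiv(-1)^{(k+1)e}F_{e-1}\,I_{2k}\pmod p, \] for every $k\ge0$, \[ R_{2k+1}^{\,e}\equiv(-1)^{ke}\,I_{2k+1}\pmod p, \] and for every $n\ge1$, $R_n^{4e}\equiv I_n\pmod p$.
   Context: Convention: $\binom{m}{k}=0$ if $k<0$ or $k>m$. The Fibonacci sequence is $F_0=0$, $F_1=1$, $F_{m+1}=F_m+F_{m-1}$. The entry point modulo $p$ is the least positive integer $e$ with $p\mid F_e$. Matrix congruences modulo $p$ are entrywise; $I_n$ is the identity matrix. -}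

module Defs where

open import Data.Nat using (ℕ; zero; suc; _∸_; _≤_; _<_)
open import Data.Nat.Divisibility using (_∣_)
open import Data.Nat.Combinatorics using (_C_)
open import Data.Fin using (Fin; toℕ)
import Data.Fin as Fin
open import Data.Integer using (ℤ; +_; _-_) renaming (_+_ to _+ℤ_; _*_ to _*ℤ_)
import Data.Integer.Divisibility as ℤDiv
open import Data.Product using (_×_)
open import Relation.Nullary using (Dec; yes; no)
open import Data.Fin using (_≟_)

F : ℕ → ℕ
F zero = 0
F (suc zero) = 1
F (suc (suc m)) = F (suc m) Data.Nat.+ F m

IsEntryPoint : ℕ → ℕ → Set
IsEntryPoint p e = (0 < e) × (p ∣ F e) × (∀ m → 0 < m → p ∣ F m → e ≤ m)

Mat : ℕ → Set
Mat n = Fin n → Fin n → ℤ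

Σℤ : (n : ℕ) → (Fin n → ℤ) → ℤ
Σℤ zero f = + 0
Σℤ (suc n) f = f Fin.zero +ℤ Σℤ n (λ i → f (Fin.suc i))

_⊗_ : {n : ℕ} → Mat n → Mat n → Mat n
_⊗_ {n} A B i j = Σℤ n (λ k → A i k *ℤ B k j)

identity : (n : ℕ) → Mat n
identity n i j with i ≟ j
... | yes _ = + 1
... | no _ = + 0

_·_ : {n : ℕ} → ℤ → Mat n → Mat n
(c · A) i j = c *ℤ A i j

_^ᴹ_ : {n : ℕ} → Mat n → ℕ → Mat n
_^ᴹ_ {n} A zero = identity n
_^ᴹ_ {n} A (suc m) = A ⊗ (A ^ᴹ m)

_≡ᴹ_[mod_] : {n : ℕ} → Mat n → Mat n → ℕ → Set
_≡ᴹ_[mod_] {n} A B p = ∀ (i j : Fin n) → (+ p) ℤDiv.∣ (A i j - B i j)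

-- R n has (i,j) entry binom(i-1, n-j) with 1-based indices i,j;
-- with 0-based indices i', j' this is binom(i', n - 1 - j').
R : (n : ℕ) → Mat n
R n i j = + (toℕ i C (n ∸ suc (toℕ j)))

module Submission where

-- Rows of R (D + 1) are the coefficient vectors of X^(D - i) (1 + X)^i, so R (D + 1) is the D-th
-- symmetric power of the Fibonacci matrix Q = [[0, 1], [1, 1]]: by the binomial theorem, multiplying
-- the symmetric power of M on the left by R gives the symmetric power of Q M. Hence R (D + 1) ^ m
-- is the symmetric power of Q^m = [[F (m - 1), F m], [F m, F (m + 1)]], which modulo p is
-- F (e - 1) · I at m = e; the symmetric power of a scalar x is x^D · I. Finally det Q = -1 gives
-- Cassini's identity F (e - 1)² ≡ (-1)^e, which turns F (e - 1)^D into the stated signs and makes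
-- Q^(4e) ≡ I.

open import Defs
open import Data.Nat.Primality using (Prime)
open import Data.Product using (_×_; _,_)

module SymmetricPowers where

  open import Data.Nat as ℕ using (ℕ; zero; suc; _∸_; _≤_; s≤s)
  import Data.Nat.Properties as ℕₚ
  import Data.Nat.Tactic.RingSolver as ℕ-Solver
  open import Data.Nat.Combinatorics using (_C_; nCk+nC[k+1]≡[n+1]C[k+1]; k>n⇒nCk≡0)
  open import Data.Nat.Divisibility using () renaming (_∣_ to _∣ℕ_)
  open import Data.Integer using (ℤ; +_; -_; _+_; _*_; _-_; _^_)
  open import Data.Integer.Properties
    using (+-identityˡ; +-identityʳ; +-inverseʳ; +-assoc; +-comm; pos-+;
           *-identityˡ; *-identityʳ; *-zeroʳ; *-assoc; *-comm; *-distribˡ-+; *-distribʳ-+;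
           ^-zeroˡ; ^-distribˡ-+-*; ^-*-assoc; +-commutativeSemigroup)
  open import Algebra.Properties.CommutativeSemigroup +-commutativeSemigroup
    using (interchange; x∙yz≈y∙xz)
  open import Data.Integer.Divisibility using () renaming (_∣_ to _∣ᵤ_)
  open import Data.Integer.Divisibility.Signed
    using (_∣_; divides; ∣ᵤ⇒∣; ∣⇒∣ᵤ; ∣m∣n⇒∣m+n; ∣m⇒∣-m; ∣n⇒∣m*n; ∣m⇒∣m*n)
  open import Data.Integer.Tactic.RingSolver using (solve-∀)
  open import Data.Fin using (Fin; toℕ)
  import Data.Fin as Fin
  open import Data.Fin.Properties using (toℕ≤pred[n]; toℕ-injective)
  open import Data.Empty using (⊥-elim)
  open import Function using (_∘_)
  open import Relation.Nullary using (yes; no)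
  open import Relation.Binary.Bundles using (Setoid)
  open import Relation.Binary.PropositionalEquality
  import Relation.Binary.Reasoning.Setoid as SetoidReasoning

  Σℤ-cong : ∀ n {f g : Fin n → ℤ} → (∀ k → f k ≡ g k) → Σℤ n f ≡ Σℤ n g
  Σℤ-cong zero    h = refl
  Σℤ-cong (suc n) h = cong₂ _+_ (h Fin.zero) (Σℤ-cong n (λ k → h (Fin.suc k)))

  ∑ : ℕ → (ℕ → ℤ) → ℤ
  ∑ n f = Σℤ n (λ k → f (toℕ k))

  ∑-zero : ∀ n {f : ℕ → ℤ} → (∀ t → f t ≡ + 0) → ∑ n f ≡ + 0
  ∑-zero zero    h = refl
  ∑-zero (suc n) h = cong₂ _+_ (h 0) (∑-zero n (λ t → h (suc t)))

  ∑-+ : ∀ n (f g : ℕ → ℤ) → ∑ n (λ t → f t + g t) ≡ ∑ n f + ∑ n g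
  ∑-+ zero    f g = refl
  ∑-+ (suc n) f g = begin
    (f 0 + g 0) + ∑ n (λ t → f (suc t) + g (suc t))
      ≡⟨ cong (_+_ (f 0 + g 0)) (∑-+ n (λ t → f (suc t)) (λ t → g (suc t))) ⟩
    (f 0 + g 0) + (∑ n (λ t → f (suc t)) + ∑ n (λ t → g (suc t)))
      ≡⟨ interchange (f 0) (g 0) (∑ n (λ t → f (suc t))) (∑ n (λ t → g (suc t))) ⟩
    (f 0 + ∑ n (λ t → f (suc t))) + (g 0 + ∑ n (λ t → g (suc t))) ∎
    where open ≡-Reasoning

  ∑-last : ∀ n (f : ℕ → ℤ) → ∑ (suc n) f ≡ ∑ n f + f n
  ∑-last zero    f = trans (+-identityʳ (f 0)) (sym (+-identityˡ (f 0)))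
  ∑-last (suc n) f = trans (cong (_+_ (f 0)) (∑-last n (λ t → f (suc t))))
                           (sym (+-assoc (f 0) (∑ n (λ t → f (suc t))) (f (suc n))))

  ∑-reverse : ∀ n (f : ℕ → ℤ) → ∑ (suc n) (λ t → f (n ∸ t)) ≡ ∑ (suc n) f
  ∑-reverse zero    f = refl
  ∑-reverse (suc n) f = begin
    f (suc n) + ∑ (suc n) (λ t → f (n ∸ t)) ≡⟨ cong (_+_ (f (suc n))) (∑-reverse n f) ⟩
    f (suc n) + ∑ (suc n) f                 ≡⟨ +-comm (f (suc n)) (∑ (suc n) f) ⟩
    ∑ (suc n) f + f (suc n)                 ≡⟨ ∑-last (suc n) f ⟨
    ∑ (suc (suc n)) f                       ∎
    where open ≡-Reasoning

  ∑-pascal : ∀ i n (f : ℕ → ℤ) →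
    ∑ (suc n) (λ t → + (suc i C t) * f t)
      ≡ ∑ n (λ t → + (i C t) * f (suc t)) + ∑ (suc n) (λ t → + (i C t) * f t)
  ∑-pascal i n f = begin
    f₀ + ∑ n (λ t → + (suc i C suc t) * f (suc t))
      ≡⟨ cong (_+_ f₀) (Σℤ-cong n (λ k → pascal (toℕ k))) ⟩
    f₀ + ∑ n (λ t → + (i C t) * f (suc t) + + (i C suc t) * f (suc t))
      ≡⟨ cong (_+_ f₀) (∑-+ n (λ t → + (i C t) * f (suc t)) (λ t → + (i C suc t) * f (suc t))) ⟩
    f₀ + (A + B)
      ≡⟨ x∙yz≈y∙xz f₀ A B ⟩
    A + (f₀ + B) ∎
    where
    open ≡-Reasoning
    -- both suc i C 0 and i C 0 compute to 1
    f₀ A B : ℤ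
    f₀ = + 1 * f 0
    A = ∑ n (λ t → + (i C t) * f (suc t))
    B = ∑ n (λ t → + (i C suc t) * f (suc t))
    pascal : ∀ t → + (suc i C suc t) * f (suc t) ≡ + (i C t) * f (suc t) + + (i C suc t) * f (suc t)
    pascal t = begin
      + (suc i C suc t) * f (suc t)
        ≡⟨ cong (λ c → + c * f (suc t)) (nCk+nC[k+1]≡[n+1]C[k+1] i t) ⟨
      + (i C t ℕ.+ i C suc t) * f (suc t)
        ≡⟨ cong (_* f (suc t)) (pos-+ (i C t) (i C suc t)) ⟩
      (+ (i C t) + + (i C suc t)) * f (suc t)
        ≡⟨ *-distribʳ-+ (f (suc t)) (+ (i C t)) (+ (i C suc t)) ⟩
      + (i C t) * f (suc t) + + (i C suc t) * f (suc t) ∎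

  -- A polynomial over ℤ is its coefficient sequence; linPow a b n s is (a + bX)ⁿ · s.
  Poly : Set
  Poly = ℕ → ℤ

  monomial : ℕ → Poly
  monomial zero    zero    = + 1
  monomial zero    (suc _) = + 0
  monomial (suc _) zero    = + 0
  monomial (suc n) (suc r) = monomial n r

  shift : Poly → Poly
  shift s zero    = + 0
  shift s (suc r) = s r

  linMul : ℤ → ℤ → Poly → Poly
  linMul a b s r = a * s r + b * shift s r

  linPow : ℤ → ℤ → ℕ → Poly → Poly
  linPow a b zero    s = s
  linPow a b (suc n) s = linMul a b (linPow a b n s)

  variable
    s t : Poly

  shift-cong : s ≗ t → shift s ≗ shift t
  shift-cong h zero    = refl
  shift-cong h (suc r) = h r

  linMul-cong : ∀ a b → s ≗ t → linMul a b s ≗ linMul a b t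
  linMul-cong a b h r = cong₂ (λ u v → a * u + b * v) (h r) (shift-cong h r)

  linPow-cong : ∀ a b n → s ≗ t → linPow a b n s ≗ linPow a b n t
  linPow-cong a b zero    h = h
  linPow-cong a b (suc n) h = linMul-cong a b (linPow-cong a b n h)

  linMul-comm : ∀ a b c d s → linMul a b (linMul c d s) ≗ linMul c d (linMul a b s)
  linMul-comm a b c d s zero    = lem a b c d (s 0)
    where
    lem : ∀ a b c d u → a * (c * u + d * + 0) + b * + 0 ≡ c * (a * u + b * + 0) + d * + 0
    lem = solve-∀
  linMul-comm a b c d s (suc r) = lem a b c d (s (suc r)) (s r) (shift s r)
    where
    lem : ∀ a b c d u v w → a * (c * u + d * v) + b * (c * v + d * w)
                          ≡ c * (a * u + b * v) + d * (a * v + b * w)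
    lem = solve-∀

  linPow-linMul-comm : ∀ a b c d n s → linPow c d n (linMul a b s) ≗ linMul a b (linPow c d n s)
  linPow-linMul-comm a b c d zero    s r = refl
  linPow-linMul-comm a b c d (suc n) s r = trans
    (linMul-cong c d (linPow-linMul-comm a b c d n s) r)
    (linMul-comm c d a b (linPow c d n s) r)

  linMul-+ : ∀ a b c d s r → linMul (a + c) (b + d) s r ≡ linMul a b s r + linMul c d s r
  linMul-+ a b c d s r = lem a b c d (s r) (shift s r)
    where
    lem : ∀ a b c d u v → (a + c) * u + (b + d) * v ≡ (a * u + b * v) + (c * u + d * v)
    lem = solve-∀

  linMul-zero : ∀ a b → linMul a b (λ _ → + 0) ≗ (λ _ → + 0)
  linMul-zero a b zero    = cong₂ _+_ (*-zeroʳ a) (*-zeroʳ b)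
  linMul-zero a b (suc r) = cong₂ _+_ (*-zeroʳ a) (*-zeroʳ b)

  linMul-linear : ∀ a b k s t →
    linMul a b (λ r → k * s r + t r) ≗ (λ r → k * linMul a b s r + linMul a b t r)
  linMul-linear a b k s t zero    = lem a b k (s 0) (t 0)
    where
    lem : ∀ a b k u v → a * (k * u + v) + b * + 0 ≡ k * (a * u + b * + 0) + (a * v + b * + 0)
    lem = solve-∀
  linMul-linear a b k s t (suc r) = lem a b k (s (suc r)) (t (suc r)) (s r) (t r)
    where
    lem : ∀ a b k u v u′ v′ →
      a * (k * u + v) + b * (k * u′ + v′) ≡ k * (a * u + b * u′) + (a * v + b * v′)
    lem = solve-∀

  linMul-∑ : ∀ a b n (k : ℕ → ℤ) (f : ℕ → Poly) →
    linMul a b (λ r → ∑ n (λ t → k t * f t r)) ≗ (λ r → ∑ n (λ t → k t * linMul a b (f t) r))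
  linMul-∑ a b zero    k f r = linMul-zero a b r
  linMul-∑ a b (suc n) k f r = trans
    (linMul-linear a b (k 0) (f 0) (λ r → ∑ n (λ t → k (suc t) * f (suc t) r)) r)
    (cong (_+_ (k 0 * linMul a b (f 0) r)) (linMul-∑ a b n (λ t → k (suc t)) (λ t → f (suc t)) r))

  -- Summing up to D rather than i lets i and D decrease together in the induction.
  linPow-binomial : ∀ a b c d s {i D} → i ≤ D →
    (λ r → ∑ (suc D) (λ t → + (i C t) * linPow c d (D ∸ t) (linPow a b t s) r))
      ≗ linPow (a + c) (b + d) i (linPow c d (D ∸ i) s)
  linPow-binomial a b c d s {zero} {D} _ r = begin
    + 1 * linPow c d D s r + ∑ D (λ t → + 0 * linPow c d (D ∸ suc t) (linPow a b (suc t) s) r)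
      ≡⟨ cong₂ _+_ (*-identityˡ (linPow c d D s r)) (∑-zero D (λ _ → refl)) ⟩
    linPow c d D s r + + 0 ≡⟨ +-identityʳ (linPow c d D s r) ⟩
    linPow c d D s r ∎
    where open ≡-Reasoning
  linPow-binomial a b c d s {suc i} {suc D} (s≤s i≤D) r = begin
    ∑ (suc (suc D)) (λ t → + (suc i C t) * P t (suc D ∸ t) r)
      ≡⟨ ∑-pascal i (suc D) (λ t → P t (suc D ∸ t) r) ⟩
    ∑ (suc D) (λ t → + (i C t) * P (suc t) (D ∸ t) r)
      + ∑ (suc (suc D)) (λ t → + (i C t) * P t (suc D ∸ t) r)
      ≡⟨ cong₂ _+_ times-a+bX times-c+dX ⟩
    linMul a b rhs r + linMul c d rhs r
      ≡⟨ linMul-+ a b c d rhs r ⟨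
    linMul (a + c) (b + d) rhs r ∎
    where
    open ≡-Reasoning
    P : ℕ → ℕ → Poly
    P t u = linPow c d u (linPow a b t s)
    rhs : Poly
    rhs = linPow (a + c) (b + d) i (linPow c d (D ∸ i) s)
    IH : (λ r → ∑ (suc D) (λ t → + (i C t) * P t (D ∸ t) r)) ≗ rhs
    IH = linPow-binomial a b c d s i≤D
    times-a+bX : ∑ (suc D) (λ t → + (i C t) * P (suc t) (D ∸ t) r) ≡ linMul a b rhs r
    times-a+bX = begin
      ∑ (suc D) (λ t → + (i C t) * P (suc t) (D ∸ t) r)
        ≡⟨ Σℤ-cong (suc D) (λ k → cong (_*_ (+ (i C toℕ k)))
             (linPow-linMul-comm a b c d (D ∸ toℕ k) (linPow a b (toℕ k) s) r)) ⟩
      ∑ (suc D) (λ t → + (i C t) * linMul a b (P t (D ∸ t)) r)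
        ≡⟨ linMul-∑ a b (suc D) (λ t → + (i C t)) (λ t → P t (D ∸ t)) r ⟨
      linMul a b (λ r → ∑ (suc D) (λ t → + (i C t) * P t (D ∸ t) r)) r
        ≡⟨ linMul-cong a b IH r ⟩
      linMul a b rhs r ∎
    front : ℤ
    front = ∑ (suc D) (λ t → + (i C t) * P t (suc D ∸ t) r)
    last-vanishes : + (i C suc D) * P (suc D) (D ∸ D) r ≡ + 0
    last-vanishes = cong (λ c → + c * P (suc D) (D ∸ D) r) (k>n⇒nCk≡0 (s≤s i≤D))
    times-c+dX : ∑ (suc (suc D)) (λ t → + (i C t) * P t (suc D ∸ t) r) ≡ linMul c d rhs r
    times-c+dX = begin
      ∑ (suc (suc D)) (λ t → + (i C t) * P t (suc D ∸ t) r)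
        ≡⟨ ∑-last (suc D) (λ t → + (i C t) * P t (suc D ∸ t) r) ⟩
      ∑ (suc D) (λ t → + (i C t) * P t (suc D ∸ t) r) + + (i C suc D) * P (suc D) (D ∸ D) r
        ≡⟨ trans (cong (_+_ front) last-vanishes) (+-identityʳ front) ⟩
      ∑ (suc D) (λ t → + (i C t) * P t (suc D ∸ t) r)
        ≡⟨ Σℤ-cong (suc D) (λ k → cong (λ u → + (i C toℕ k) * P (toℕ k) u r)
             (ℕₚ.+-∸-assoc 1 (toℕ≤pred[n] k))) ⟩
      ∑ (suc D) (λ t → + (i C t) * linMul c d (P t (D ∸ t)) r)
        ≡⟨ linMul-∑ c d (suc D) (λ t → + (i C t)) (λ t → P t (D ∸ t)) r ⟨
      linMul c d (λ r → ∑ (suc D) (λ t → + (i C t) * P t (D ∸ t) r)) r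
        ≡⟨ linMul-cong c d IH r ⟩
      linMul c d rhs r ∎

  linPow-scalar : ∀ x n s → linPow x (+ 0) n s ≗ (λ r → x ^ n * s r)
  linPow-scalar x zero    s r = sym (*-identityˡ (s r))
  linPow-scalar x (suc n) s r = begin
    linMul x (+ 0) (linPow x (+ 0) n s) r       ≡⟨ linMul-cong x (+ 0) (linPow-scalar x n s) r ⟩
    x * (x ^ n * s r) + + 0 * shift (λ r → x ^ n * s r) r
                                                ≡⟨ +-identityʳ (x * (x ^ n * s r)) ⟩
    x * (x ^ n * s r)                           ≡⟨ *-assoc x (x ^ n) (s r) ⟨
    x ^ suc n * s r                             ∎
    where open ≡-Reasoning

  linMul-X-monomial : ∀ x y n →
    linMul (+ 0) x (λ r → y * monomial n r) ≗ (λ r → (x * y) * monomial (suc n) r)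
  linMul-X-monomial x y n zero    = lem x y (monomial n 0)
    where
    lem : ∀ x y u → + 0 * (y * u) + x * + 0 ≡ (x * y) * + 0
    lem = solve-∀
  linMul-X-monomial x y n (suc r) = lem x y (monomial n (suc r)) (monomial n r)
    where
    lem : ∀ x y u v → + 0 * (y * u) + x * (y * v) ≡ (x * y) * v
    lem = solve-∀

  linPow-X : ∀ x n y →
    linPow (+ 0) x n (λ r → y * monomial 0 r) ≗ (λ r → (x ^ n * y) * monomial n r)
  linPow-X x zero    y r = cong (_* monomial 0 r) (sym (*-identityˡ y))
  linPow-X x (suc n) y r = begin
    linMul (+ 0) x (linPow (+ 0) x n (λ r → y * monomial 0 r)) r
      ≡⟨ linMul-cong (+ 0) x (linPow-X x n y) r ⟩
    linMul (+ 0) x (λ r → (x ^ n * y) * monomial n r) r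
      ≡⟨ linMul-X-monomial x (x ^ n * y) n r ⟩
    (x * (x ^ n * y)) * monomial (suc n) r
      ≡⟨ cong (_* monomial (suc n) r) (*-assoc x (x ^ n) y) ⟨
    (x ^ suc n * y) * monomial (suc n) r ∎
    where open ≡-Reasoning

  record Mat₂ : Set where
    constructor mat₂
    field a b c d : ℤ

  I₂ : Mat₂
  I₂ = mat₂ (+ 1) (+ 0) (+ 0) (+ 1)

  scalar : ℤ → Mat₂
  scalar x = mat₂ x (+ 0) (+ 0) x

  _·₂_ : ℤ → Mat₂ → Mat₂
  x ·₂ mat₂ a b c d = mat₂ (x * a) (x * b) (x * c) (x * d)

  ·₂-I₂ : ∀ x → x ·₂ I₂ ≡ scalar x
  ·₂-I₂ x = cong₂ (λ u v → mat₂ u v v u) (*-identityʳ x) (*-zeroʳ x)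

  Qmul : Mat₂ → Mat₂
  Qmul (mat₂ a b c d) = mat₂ c d (a + c) (b + d)

  Qpow : ℕ → Mat₂
  Qpow zero    = I₂
  Qpow (suc m) = Qmul (Qpow m)

  Qpow-suc : ∀ m → Qpow (suc m) ≡ mat₂ (+ F m) (+ F (suc m)) (+ F (suc m)) (+ F (suc (suc m)))
  Qpow-suc zero    = refl
  Qpow-suc (suc m) = begin
    Qmul (Qpow (suc m))   ≡⟨ cong Qmul (Qpow-suc m) ⟩
    mat₂ (+ F (suc m)) (+ F (suc (suc m))) (+ (F m ℕ.+ F (suc m)))
         (+ (F (suc m) ℕ.+ F (suc (suc m))))
      ≡⟨ cong₂ (λ u v → mat₂ (+ F (suc m)) (+ F (suc (suc m))) (+ u) (+ v))
           (ℕₚ.+-comm (F m) (F (suc m))) (ℕₚ.+-comm (F (suc m)) (F (suc (suc m)))) ⟩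
    mat₂ (+ F (suc m)) (+ F (suc (suc m))) (+ F (suc (suc m))) (+ F (suc (suc (suc m)))) ∎
    where open ≡-Reasoning

  det : Mat₂ → ℤ
  det (mat₂ a b c d) = a * d - b * c

  det-Qpow : ∀ m → det (Qpow m) ≡ (- + 1) ^ m
  det-Qpow zero    = refl
  det-Qpow (suc m) = trans (det-Qmul (Qpow m)) (cong (_*_ (- + 1)) (det-Qpow m))
    where
    det-Qmul : ∀ M → det (Qmul M) ≡ - + 1 * det M
    det-Qmul (mat₂ a b c d) = lem a b c d
      where
      lem : ∀ a b c d → c * (b + d) - d * (a + c) ≡ - + 1 * (a * d - b * c)
      lem = solve-∀

  -- The D-th symmetric power of [[a, b], [c, d]]: row i holds the coefficients of
  -- (a + bX)^(D - i) (c + dX)^i.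
  symPow : (D : ℕ) → Mat₂ → Mat (suc D)
  symPow D (mat₂ a b c d) i j =
    linPow c d (toℕ i) (linPow a b (D ∸ toℕ i) (monomial 0)) (toℕ j)

  monomial-diagonal : ∀ n → monomial n n ≡ + 1
  monomial-diagonal zero    = refl
  monomial-diagonal (suc n) = monomial-diagonal n

  monomial-off-diagonal : ∀ m n → m ≢ n → monomial m n ≡ + 0
  monomial-off-diagonal zero    zero    m≢n = ⊥-elim (m≢n refl)
  monomial-off-diagonal zero    (suc n) _   = refl
  monomial-off-diagonal (suc m) zero    _   = refl
  monomial-off-diagonal (suc m) (suc n) m≢n = monomial-off-diagonal m n (m≢n ∘ cong suc)

  identity≡monomial : ∀ n (i j : Fin n) → identity n i j ≡ monomial (toℕ i) (toℕ j)
  identity≡monomial n i j with i Fin.≟ j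
  ... | yes refl = sym (monomial-diagonal (toℕ i))
  ... | no i≢j   = sym (monomial-off-diagonal (toℕ i) (toℕ j) (i≢j ∘ toℕ-injective))

  symPow-scalar : ∀ D x (i j : Fin (suc D)) →
    symPow D (scalar x) i j ≡ x ^ D * identity (suc D) i j
  symPow-scalar D x i j = begin
    linPow (+ 0) x (toℕ i) (linPow x (+ 0) (D ∸ toℕ i) (monomial 0)) (toℕ j)
      ≡⟨ linPow-cong (+ 0) x (toℕ i) (linPow-scalar x (D ∸ toℕ i) (monomial 0)) (toℕ j) ⟩
    linPow (+ 0) x (toℕ i) (λ r → x ^ (D ∸ toℕ i) * monomial 0 r) (toℕ j)
      ≡⟨ linPow-X x (toℕ i) (x ^ (D ∸ toℕ i)) (toℕ j) ⟩
    (x ^ toℕ i * x ^ (D ∸ toℕ i)) * monomial (toℕ i) (toℕ j)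
      ≡⟨ cong₂ _*_ (^-distribˡ-+-* x (toℕ i) (D ∸ toℕ i)) (identity≡monomial (suc D) i j) ⟨
    x ^ (toℕ i ℕ.+ (D ∸ toℕ i)) * identity (suc D) i j
      ≡⟨ cong (λ n → x ^ n * identity (suc D) i j) (ℕₚ.m+[n∸m]≡n (toℕ≤pred[n] i)) ⟩
    x ^ D * identity (suc D) i j ∎
    where open ≡-Reasoning

  R⊗symPow : ∀ D M (i j : Fin (suc D)) → (R (suc D) ⊗ symPow D M) i j ≡ symPow D (Qmul M) i j
  R⊗symPow D M@(mat₂ a b c d) i j = begin
    ∑ (suc D) (λ t → + (toℕ i C (D ∸ t)) * P (D ∸ t) t)
      ≡⟨ Σℤ-cong (suc D) (λ k → cong (λ u → + (toℕ i C (D ∸ toℕ k)) * P (D ∸ toℕ k) u)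
           (sym (ℕₚ.m∸[m∸n]≡n (toℕ≤pred[n] k)))) ⟩
    ∑ (suc D) (λ t → term (D ∸ t))
      ≡⟨ ∑-reverse D term ⟩
    ∑ (suc D) term
      ≡⟨ linPow-binomial a b c d (monomial 0) (toℕ≤pred[n] i) (toℕ j) ⟩
    symPow D (Qmul M) i j ∎
    where
    open ≡-Reasoning
    P : ℕ → ℕ → ℤ
    P α β = linPow c d β (linPow a b α (monomial 0)) (toℕ j)
    term : ℕ → ℤ
    term t = + (toℕ i C t) * P t (D ∸ t)

  R^≡symPow : ∀ D m (i j : Fin (suc D)) → (R (suc D) ^ᴹ m) i j ≡ symPow D (Qpow m) i j
  R^≡symPow D zero    i j = begin
    identity (suc D) i j             ≡⟨ *-identityˡ (identity (suc D) i j) ⟨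
    + 1 * identity (suc D) i j       ≡⟨ cong (_* identity (suc D) i j) (^-zeroˡ D) ⟨
    (+ 1) ^ D * identity (suc D) i j ≡⟨ symPow-scalar D (+ 1) i j ⟨
    symPow D I₂ i j                  ∎
    where open ≡-Reasoning
  R^≡symPow D (suc m) i j = trans
    (Σℤ-cong (suc D) (λ k → cong (_*_ (R (suc D) i k)) (R^≡symPow D m k j)))
    (R⊗symPow D (Qpow m) i j)

  module Modulo (p : ℕ) where

    infix 4 _≈_
    record _≈_ (x y : ℤ) : Set where
      constructor mk≈
      field divides-difference : + p ∣ x - y
    open _≈_

    ≈-via : ∀ {u x y} → + p ∣ u → u ≡ x - y → x ≈ y
    ≈-via p∣u refl = mk≈ p∣u

    ≈-reflexive : ∀ {x y} → x ≡ y → x ≈ y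
    ≈-reflexive {x} refl = ≈-via (divides (+ 0) refl) (sym (+-inverseʳ x))

    ≈-refl : ∀ {x} → x ≈ x
    ≈-refl = ≈-reflexive refl

    ≈-sym : ∀ {x y} → x ≈ y → y ≈ x
    ≈-sym {x} {y} (mk≈ h) = ≈-via (∣m⇒∣-m h) (lem x y)
      where
      lem : ∀ x y → - (x - y) ≡ y - x
      lem = solve-∀

    ≈-trans : ∀ {x y z} → x ≈ y → y ≈ z → x ≈ z
    ≈-trans {x} {y} {z} (mk≈ h) (mk≈ k) = ≈-via (∣m∣n⇒∣m+n h k) (lem x y z)
      where
      lem : ∀ x y z → (x - y) + (y - z) ≡ x - z
      lem = solve-∀

    ≈-setoid : Setoid _ _
    ≈-setoid = record
      { Carrier = ℤ
      ; _≈_ = _≈_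
      ; isEquivalence = record { refl = ≈-refl ; sym = ≈-sym ; trans = ≈-trans }
      }

    +-cong : ∀ {x x′ y y′} → x ≈ x′ → y ≈ y′ → x + y ≈ x′ + y′
    +-cong {x} {x′} {y} {y′} (mk≈ h) (mk≈ k) =
      ≈-via (∣m∣n⇒∣m+n h k) (lem x x′ y y′)
      where
      lem : ∀ x x′ y y′ → (x - x′) + (y - y′) ≡ (x + y) - (x′ + y′)
      lem = solve-∀

    -‿cong : ∀ {x y} → x ≈ y → - x ≈ - y
    -‿cong {x} {y} (mk≈ h) = ≈-via (∣m⇒∣-m h) (lem x y)
      where
      lem : ∀ x y → - (x - y) ≡ - x - - y
      lem = solve-∀

    *-cong : ∀ {x x′ y y′} → x ≈ x′ → y ≈ y′ → x * y ≈ x′ * y′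
    *-cong {x} {x′} {y} {y′} (mk≈ h) (mk≈ k) =
      ≈-via (∣m∣n⇒∣m+n (∣n⇒∣m*n x k) (∣m⇒∣m*n y′ h)) (lem x x′ y y′)
      where
      lem : ∀ x x′ y y′ → x * (y - y′) + (x - x′) * y′ ≡ x * y - x′ * y′
      lem = solve-∀

    ^-cong : ∀ {x y} → x ≈ y → ∀ n → x ^ n ≈ y ^ n
    ^-cong h zero    = ≈-refl
    ^-cong h (suc n) = *-cong h (^-cong h n)

    _≈ₚ_ : Poly → Poly → Set
    s ≈ₚ t = ∀ r → s r ≈ t r

    shift-cong-mod : s ≈ₚ t → shift s ≈ₚ shift t
    shift-cong-mod h zero    = ≈-refl
    shift-cong-mod h (suc r) = h r

    linPow-cong-mod : ∀ {a a′ b b′} → a ≈ a′ → b ≈ b′ → s ≈ₚ t →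
                      ∀ n → linPow a b n s ≈ₚ linPow a′ b′ n t
    linPow-cong-mod ha hb h zero    = h
    linPow-cong-mod {s = s} {t} {a} {a′} {b} {b′} ha hb h (suc n) r =
      +-cong (*-cong ha (IH r)) (*-cong hb (shift-cong-mod IH r))
      where
      IH : linPow a b n s ≈ₚ linPow a′ b′ n t
      IH = linPow-cong-mod ha hb h n

    infix 4 _≋_
    _≋_ : Mat₂ → Mat₂ → Set
    mat₂ a b c d ≋ mat₂ a′ b′ c′ d′ =
      (a ≈ a′) × (b ≈ b′) × (c ≈ c′) × (d ≈ d′)

    ≋-refl : ∀ {M} → M ≋ M
    ≋-refl = ≈-refl , ≈-refl , ≈-refl , ≈-refl

    det-cong : ∀ {M N} → M ≋ N → det M ≈ det N
    det-cong {mat₂ _ _ _ _} {mat₂ _ _ _ _} (ha , hb , hc , hd) =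
      +-cong (*-cong ha hd) (-‿cong (*-cong hb hc))

    symPow-cong : ∀ D {M N} → M ≋ N → ∀ i j → symPow D M i j ≈ symPow D N i j
    symPow-cong D {mat₂ _ _ _ _} {mat₂ _ _ _ _} (ha , hb , hc , hd) i j =
      linPow-cong-mod hc hd (linPow-cong-mod ha hb (λ _ → ≈-refl) (D ∸ toℕ i)) (toℕ i) (toℕ j)

    Qmul-scaled : ∀ x M N → M ≋ x ·₂ N → Qmul M ≋ x ·₂ Qmul N
    Qmul-scaled x (mat₂ _ _ _ _) (mat₂ a b c d) (ha , hb , hc , hd) =
      hc , hd ,
      ≈-trans (+-cong ha hc) (≈-reflexive (sym (*-distribˡ-+ x a c))) ,
      ≈-trans (+-cong hb hd) (≈-reflexive (sym (*-distribˡ-+ x b d)))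

    scaled-trans : ∀ x y M N P → M ≋ x ·₂ N → N ≋ y ·₂ P → M ≋ (x * y) ·₂ P
    scaled-trans x y (mat₂ _ _ _ _) (mat₂ _ _ _ _) (mat₂ _ _ _ _)
                 (ha , hb , hc , hd) (ha′ , hb′ , hc′ , hd′) =
      compose ha ha′ , compose hb hb′ , compose hc hc′ , compose hd hd′
      where
      compose : ∀ {u v w} → u ≈ x * v → v ≈ y * w → u ≈ (x * y) * w
      compose {w = w} h h′ =
        ≈-trans h (≈-trans (*-cong (≈-refl {x}) h′) (≈-reflexive (sym (*-assoc x y w))))

    Qpow-+ : ∀ n x → Qpow n ≋ x ·₂ I₂ → ∀ m → Qpow (m ℕ.+ n) ≋ x ·₂ Qpow m
    Qpow-+ n x h zero    = h
    Qpow-+ n x h (suc m) = Qmul-scaled x (Qpow (m ℕ.+ n)) (Qpow m) (Qpow-+ n x h m)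

    Qpow-* : ∀ n x → Qpow n ≋ x ·₂ I₂ → ∀ k → Qpow (k ℕ.* n) ≋ (x ^ k) ·₂ I₂
    Qpow-* n x h zero    = ≋-refl
    Qpow-* n x h (suc k) = subst (λ m → Qpow m ≋ (x ^ suc k) ·₂ I₂) (ℕₚ.+-comm (k ℕ.* n) n)
      (scaled-trans x (x ^ k) (Qpow (k ℕ.* n ℕ.+ n)) (Qpow (k ℕ.* n)) I₂
                    (Qpow-+ n x h (k ℕ.* n)) (Qpow-* n x h k))

    R^≈scalar : ∀ m x {c} n → Qpow m ≋ x ·₂ I₂ → x ^ (n ∸ 1) ≈ c →
                ∀ i j → (R n ^ᴹ m) i j ≈ c * identity n i j
    R^≈scalar m x {c} (suc D) h hx i j = begin
      (R (suc D) ^ᴹ m) i j          ≡⟨ R^≡symPow D m i j ⟩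
      symPow D (Qpow m) i j         ≈⟨ symPow-cong D (subst (Qpow m ≋_) (·₂-I₂ x) h) i j ⟩
      symPow D (scalar x) i j       ≡⟨ symPow-scalar D x i j ⟩
      x ^ D * identity (suc D) i j  ≈⟨ *-cong hx (≈-refl {identity (suc D) i j}) ⟩
      c * identity (suc D) i j      ∎
      where open SetoidReasoning ≈-setoid

    R^≡ᴹscalar : ∀ m x {c} n → Qpow m ≋ x ·₂ I₂ → x ^ (n ∸ 1) ≈ c →
                 (R n ^ᴹ m) ≡ᴹ (c · identity n) [mod p ]
    R^≡ᴹscalar m x n h hx i j = ∣⇒∣ᵤ (divides-difference (R^≈scalar m x n h hx i j))

  ^-absorb : ∀ μ x m n → μ ^ n ≡ + 1 → x * μ ^ m ≡ μ ^ (m ℕ.+ n) * x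
  ^-absorb μ x m n μⁿ≡1 = begin
    x * μ ^ m            ≡⟨ cong (_*_ x) (*-identityʳ (μ ^ m)) ⟨
    x * (μ ^ m * + 1)    ≡⟨ cong (λ u → x * (μ ^ m * u)) μⁿ≡1 ⟨
    x * (μ ^ m * μ ^ n)  ≡⟨ cong (_*_ x) (^-distribˡ-+-* μ m n) ⟨
    x * μ ^ (m ℕ.+ n)    ≡⟨ *-comm x (μ ^ (m ℕ.+ n)) ⟩
    μ ^ (m ℕ.+ n) * x    ∎
    where open ≡-Reasoning

  [-1]^[2n]≡1 : ∀ n → (- + 1) ^ (2 ℕ.* n) ≡ + 1
  [-1]^[2n]≡1 n = trans (sym (^-*-assoc (- + 1) 2 n)) (^-zeroˡ n)

  module EntryPoint (p e′ : ℕ) (p∣F[e] : p ∣ℕ F (suc e′)) where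
    open Modulo p
    open SetoidReasoning ≈-setoid

    e : ℕ
    e = suc e′

    l : ℤ
    l = + F e′

    F[e]≈0 : + F e ≈ + 0
    F[e]≈0 = ≈-via (∣ᵤ⇒∣ p∣F[e]) (sym (+-identityʳ (+ F e)))

    Qpow[e]≋l·I₂ : Qpow e ≋ l ·₂ I₂
    Qpow[e]≋l·I₂ = subst (_≋ l ·₂ I₂) (sym (Qpow-suc e′))
      ( ≈-reflexive (sym (*-identityʳ l))
      , ≈-trans F[e]≈0 (≈-reflexive (sym (*-zeroʳ l)))
      , ≈-trans F[e]≈0 (≈-reflexive (sym (*-zeroʳ l)))
      , ≈-trans (+-cong F[e]≈0 (≈-refl {l})) (≈-reflexive (sym (*-identityʳ l))) )

    -- Cassini's identity F (e - 1) F (e + 1) - F e ² = (-1)^e, with F e ≡ 0.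
    cassini : l * l ≈ (- + 1) ^ e
    cassini = begin
      l * l          ≡⟨ det-scalar l ⟩
      det (l ·₂ I₂)  ≈⟨ det-cong Qpow[e]≋l·I₂ ⟨
      det (Qpow e)   ≡⟨ det-Qpow e ⟩
      (- + 1) ^ e    ∎
      where
      det-scalar : ∀ l → l * l ≡ (l * + 1) * (l * + 1) - (l * + 0) * (l * + 0)
      det-scalar = solve-∀

    l^[2k]≈ : ∀ k → l ^ (2 ℕ.* k) ≈ (- + 1) ^ (k ℕ.* e)
    l^[2k]≈ k = begin
      l ^ (2 ℕ.* k)          ≡⟨ ^-*-assoc l 2 k ⟨
      (l ^ 2) ^ k            ≡⟨ cong (λ u → (l * u) ^ k) (*-identityʳ l) ⟩
      (l * l) ^ k            ≈⟨ ^-cong cassini k ⟩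
      ((- + 1) ^ e) ^ k      ≡⟨ ^-*-assoc (- + 1) e k ⟩
      (- + 1) ^ (e ℕ.* k)    ≡⟨ cong ((- + 1) ^_) (ℕₚ.*-comm e k) ⟩
      (- + 1) ^ (k ℕ.* e)    ∎

    even-dimension : ∀ k → l ^ (2 ℕ.* suc k ∸ 1) ≈ (- + 1) ^ ((suc k ℕ.+ 1) ℕ.* e) * l
    even-dimension k = begin
      l ^ (2 ℕ.* suc k ∸ 1)
        ≡⟨ cong (l ^_) (ℕₚ.+-suc k (k ℕ.+ 0)) ⟩
      l * l ^ (2 ℕ.* k)
        ≈⟨ *-cong (≈-refl {l}) (l^[2k]≈ k) ⟩
      l * (- + 1) ^ (k ℕ.* e)
        ≡⟨ ^-absorb (- + 1) l (k ℕ.* e) (2 ℕ.* e) ([-1]^[2n]≡1 e) ⟩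
      (- + 1) ^ (k ℕ.* e ℕ.+ 2 ℕ.* e) * l
        ≡⟨ cong (λ n → (- + 1) ^ n * l) (exponent k e) ⟩
      (- + 1) ^ ((suc k ℕ.+ 1) ℕ.* e) * l ∎
      where
      exponent : ∀ k e → k ℕ.* e ℕ.+ 2 ℕ.* e ≡ (suc k ℕ.+ 1) ℕ.* e
      exponent = ℕ-Solver.solve-∀

    odd-dimension : ∀ k → l ^ (2 ℕ.* k ℕ.+ 1 ∸ 1) ≈ (- + 1) ^ (k ℕ.* e)
    odd-dimension k = begin
      l ^ (2 ℕ.* k ℕ.+ 1 ∸ 1)   ≡⟨ cong (l ^_) (ℕₚ.m+n∸n≡m (2 ℕ.* k) 1) ⟩
      l ^ (2 ℕ.* k)             ≈⟨ l^[2k]≈ k ⟩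
      (- + 1) ^ (k ℕ.* e)       ∎

    l⁴-dimension : ∀ n → (l ^ 4) ^ (n ∸ 1) ≈ + 1
    l⁴-dimension n = begin
      (l ^ 4) ^ (n ∸ 1)              ≈⟨ ^-cong (l^[2k]≈ 2) (n ∸ 1) ⟩
      ((- + 1) ^ (2 ℕ.* e)) ^ (n ∸ 1) ≡⟨ cong (_^ (n ∸ 1)) ([-1]^[2n]≡1 e) ⟩
      (+ 1) ^ (n ∸ 1)                ≡⟨ ^-zeroˡ (n ∸ 1) ⟩
      + 1                            ∎

    R^e≡ᴹ : ∀ {c} n → l ^ (n ∸ 1) ≈ c → (R n ^ᴹ e) ≡ᴹ (c · identity n) [mod p ]
    R^e≡ᴹ n = R^≡ᴹscalar e l n Qpow[e]≋l·I₂

    R^[4e]≡ᴹI : ∀ n → (R n ^ᴹ (4 ℕ.* e)) ≡ᴹ identity n [mod p ]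
    R^[4e]≡ᴹI n i j =
      subst (λ b → + p ∣ᵤ (R n ^ᴹ (4 ℕ.* e)) i j - b) (*-identityˡ (identity n i j))
            (R^≡ᴹscalar (4 ℕ.* e) (l ^ 4) n (Qpow-* e l Qpow[e]≋l·I₂ 4) (l⁴-dimension n) i j)

open SymmetricPowers
open import Data.Nat using (ℕ; zero; suc; _+_; _*_; _∸_; _≥_)
open import Data.Integer using (+_; -_) renaming (_^_ to _^ℤ_)

theorem9 : (p e : ℕ) → Prime p → IsEntryPoint p e →
  ((k : ℕ) → k ≥ 1 →
    ((R (2 * k)) ^ᴹ e) ≡ᴹ (((- (+ 1)) ^ℤ ((k + 1) * e)) Data.Integer.* (+ F (e ∸ 1))) · identity (2 * k) [mod p ])
  × ((k : ℕ) →
    ((R (2 * k + 1)) ^ᴹ e) ≡ᴹ ((- (+ 1)) ^ℤ (k * e)) · identity (2 * k + 1) [mod p ])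
  × ((n : ℕ) → n ≥ 1 → ((R n) ^ᴹ (4 * e)) ≡ᴹ identity n [mod p ])
theorem9 p zero     _ (() , _)
theorem9 p (suc e′) _ (_ , p∣F[e] , _) =
    (λ { (suc k) _ → R^e≡ᴹ (2 * suc k) (even-dimension k) })
  , (λ k → R^e≡ᴹ (2 * k + 1) (odd-dimension k))
  , (λ n _ → R^[4e]≡ᴹI n)
  where open EntryPoint p e′ p∣F[e]
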